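{- Let $G$ be a graph with $|V(G)|=2^k$, where each vertex $u$ is assigned a distinct string $\mathrm{enc}(u)\in\{0,1\}^k$. Let $P=\{\mathrm{enc}(u)\,1\,\mathrm{enc}(u)^R : u\in V(G)\}$ and $N=\{\mathrm{enc}(u)\,1\,\mathrm{enc}(v)^R : uv\in E(G)\}$. Let $M=(Q,\{0,1\},\delta,q_0,F)$ be an NFA consistent with $(P,N)$. Then for every vertex $u\in V(G)$, $$\delta^*(q_0,\mathrm{enc}(u))\not\subseteq\bigcup_{v:\,uv\in E(G)}\delta^*(q_0,\mathrm{enc}(v)).$$
   Context: $x^R$ denotes the reversal of string $x$; juxtaposition denotes concatenation. Edges of $G$ are undirected, so both $\mathrm{enc}(u)1\mathrm{enc}(v)^R$ and $\mathrm{enc}(v)1\mathrm{enc}(u)^R$ are in $N$ for $uv\in E(G)$. An NFA has transition function $\delta:Q\times\{0,1\}\to 2^Q$, extended to strings as $\delta^*$, and accepts $x$ iff $\delta^*(q_0,x)\cap F\neq\emptyset$; it is consistent with $(P,N)$ if it accepts all of $P$ and rejects all of $N$. -}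

module Defs where

open import Data.Nat using (ℕ)
open import Data.Bool using (Bool; true)
open import Data.Fin using (Fin)
open import Data.List using (List; []; _∷_; _++_; reverse)
open import Data.Product using (Σ; _×_)
open import Relation.Binary.PropositionalEquality using (_≡_)
open import Relation.Nullary using (¬_)

Word : Set
Word = List Bool

record Graph (n : ℕ) : Set₁ where
  field
    Adj   : Fin n → Fin n → Set
    sym   : ∀ {u v} → Adj u v → Adj v u
    irrefl : ∀ {u} → ¬ Adj u u

-- An NFA over {0,1} (Bool, with true = 1) with finite state set Fin m.
-- Subsets of Q are predicates Q → Set; δ q a q' means q' ∈ δ(q,a).
record NFA (m : ℕ) : Set₁ where
  field
    δ  : Fin m → Bool → Fin m → Set
    q₀ : Fin m
    F  : Fin m → Set

module _ {m : ℕ} (M : NFA m) where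
  open NFA M

  data δ* : Fin m → Word → Fin m → Set where
    ε-step : ∀ {q} → δ* q [] q
    step   : ∀ {q q' q'' a w} → δ q a q' → δ* q' w q'' → δ* q (a ∷ w) q''

  Accepts : Word → Set
  Accepts x = Σ (Fin m) λ q → δ* q₀ x q × F q

  Consistent : (Word → Set) → (Word → Set) → Set
  Consistent P N = (∀ x → P x → Accepts x) × (∀ x → N x → ¬ Accepts x)

glue : Word → Word → Word
glue x y = x ++ (true ∷ reverse y)

-- If every state reached on enc(u) were also reached on enc(v) for some
-- neighbour v, then the accepting run on the positive word enc(u) 1 enc(u)^R
-- could be rerouted at the end of its prefix enc(u) into an accepting run on
-- the negative word enc(v) 1 enc(u)^R, contradicting consistency.
module Submission where

open import Defs
open import Data.Nat using (ℕ; _^_)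
open import Data.Bool using (Bool; true)
open import Data.Fin using (Fin)
open import Data.Vec using (Vec; toList)
open import Data.List using (_++_; []; _∷_; reverse)
open import Data.Product using (Σ; _×_; _,_)
open import Function.Definitions using (Injective)
open import Relation.Binary.PropositionalEquality using (_≡_; refl)
open import Relation.Nullary using (¬_)

module _ {m : ℕ} (M : NFA m) where
  open NFA M using (q₀)

  δ*-++⁻ : ∀ {q q''} (x y : Word) → δ* M q (x ++ y) q''
         → Σ (Fin m) λ q' → δ* M q x q' × δ* M q' y q''
  δ*-++⁻ []      y r          = _ , ε-step , r
  δ*-++⁻ (a ∷ x) y (step d r) with δ*-++⁻ x y r
  ... | q' , rx , ry = q' , step d rx , ry

  δ*-++⁺ : ∀ {q q' q''} (x y : Word) → δ* M q x q' → δ* M q' y q'' → δ* M q (x ++ y) q''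
  δ*-++⁺ []      y ε-step      ry = ry
  δ*-++⁺ (a ∷ x) y (step d rx) ry = step d (δ*-++⁺ x y rx ry)

  accepts-++-cover : {I : Set} (R : I → Set) (w : I → Word) (x z : Word)
    → (∀ q → δ* M q₀ x q → Σ I λ i → R i × δ* M q₀ (w i) q)
    → Accepts M (x ++ z) → Σ I λ i → R i × Accepts M (w i ++ z)
  accepts-++-cover R w x z cover (qf , run , qf∈F) with δ*-++⁻ x z run
  ... | q , rx , rz with cover q rx
  ... | i , Ri , rw = i , Ri , qf , δ*-++⁺ (w i) z rw rz , qf∈F

lemma5p2 : (k n m : ℕ) → n ≡ 2 ^ k → (G : Graph n)
    → (enc : Fin n → Vec Bool k) → Injective _≡_ _≡_ enc
    → (M : NFA m)
    → Consistent M
        (λ x → Σ (Fin n) λ u → x ≡ glue (toList (enc u)) (toList (enc u)))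
        (λ x → Σ (Fin n) λ u → Σ (Fin n) λ v →
           Graph.Adj G u v × (x ≡ glue (toList (enc u)) (toList (enc v))))
    → (u : Fin n)
    → ¬ (∀ q → δ* M (NFA.q₀ M) (toList (enc u)) q
           → Σ (Fin n) λ v → Graph.Adj G u v × δ* M (NFA.q₀ M) (toList (enc v)) q)
lemma5p2 k n m _ G enc _ M (accepts-P , rejects-N) u cover
  with accepts-++-cover M (Graph.Adj G u) (λ v → toList (enc v))
         (toList (enc u)) (true ∷ reverse (toList (enc u)))
         cover (accepts-P _ (u , refl))
... | v , uv , accepted = rejects-N _ (v , u , Graph.sym G uv , refl) accepted
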